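{- Let $n\ge1$, let $e\in\mathbf{I}_n(021)$, and let $\ell\ge 0$ be an integer with $\ell+1\le n$ and $e_1=e_2=\cdots=e_{\ell+1}=0$. Then the top $\ell$ nodes of the leftmost branch of $\tau(e)$ (the root and the next $\ell-1$ nodes along the branch) are white.
   Context: An inversion sequence of length $n$ is an integer sequence $e=(e_1,\ldots,e_n)$ with $0 \le e_i < i$ for all $i$; $\mathbf{I}_n(021)$ is the set of those with no $i<j<k$ such that $e_i<e_k<e_j$. $\mathcal{T}_m$ is the set of rooted binary trees on $m$ nodes (left and right children distinguished), each node colored black or white, such that no node has the same color as its right child; $\mathcal{T}_0$ is the empty tree. The leftmost branch of a nonempty tree is the path starting at the root and repeatedly moving to the left child while one exists. For trees $T,S$, $\omega(T,S)$ (resp. $\beta(T,S)$) is the tree with a white (resp. black) root whose left subtree is $T$ and right subtree is $S$. For an integer $t$ and a sequence $(f_1,\ldots,f_m)$, $\sigma_t(f_1,\ldots,f_m)$ is obtained by adding $t$ to every nonzero entry and leaving zeros unchanged; $0^\ell$ denotes $\ell$ zeros and $\cdot$ denotes concatenation. The map $\tau:\mathbf{I}_n(021)\to\mathcal{T}_{n-1}$ is defined recursively: $\tau((0))$ is the empty tree. For $n\ge2$, let $\ell'\ge1$ be the largest integer with $e_2=e_3=\cdots=e_{\ell'+1}$; let $k+1$ be the smallest position $k+1>\ell'+1$ with $e_{k+1}\ge k-\ell'+1$, and $k=n$ if there is no such position. Then $\tau(e)=\omega\big(\tau(0^{\ell'}\cdot\sigma_{\ell'-k}(e_{k+1},\ldots,e_n)),\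 \tau(0,e_{\ell'+2},\ldots,e_k)\big)$ if $e_2=0$, and $\tau(e)=\beta\big(\tau(0^{\ell'}\cdot\sigma_{\ell'-k}(e_{k+1},\ldots,e_n)),\ \tau(0,e_{\ell'+2},\ldots,e_k)\big)$ if $e_2=1$. -}

module Defs where

open import Data.Nat using (ℕ; zero; suc; _+_; _∸_; _≤_; _<_; _≡ᵇ_; _≤ᵇ_)
open import Data.Bool using (Bool; true; false; if_then_else_)
open import Data.List using (List; []; _∷_; _++_; map; replicate; length)
open import Data.Product using (_×_; _,_)
open import Data.Fin using (Fin; toℕ)
open import Data.Vec using (Vec; lookup)
open import Relation.Nullary using (¬_)

-- An inversion sequence of length n, e = (e_1,…,e_n), is a vector whose
-- entry at 0-based index i (i.e. e_{i+1}) satisfies e_{i+1} < i+1, i.e. ≤ i.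
IsInvSeq : ∀ {n} → Vec ℕ n → Set
IsInvSeq {n} e = (i : Fin n) → lookup e i ≤ toℕ i

Avoids021 : ∀ {n} → Vec ℕ n → Set
Avoids021 {n} e = (i j k : Fin n) → toℕ i < toℕ j → toℕ j < toℕ k →
  ¬ (lookup e i < lookup e k × lookup e k < lookup e j)

data Color : Set where
  white black : Color

data Tree : Set where
  leaf : Tree
  node : Color → Tree → Tree → Tree

leftBranch : Tree → List Color
leftBranch leaf = []
leftBranch (node c l r) = c ∷ leftBranch l

prefixLen : ℕ → List ℕ → ℕ
prefixLen a [] = 0
prefixLen a (x ∷ xs) = if a ≡ᵇ x then suc (prefixLen a xs) else 0

-- splitAt2 j xs: xs = (e_{ℓ'+2},…,e_n); an entry at 0-based index j there sits
-- at position p = ℓ'+2+j, and the condition e_p ≥ p - ℓ' reads x ≥ j+2.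
-- Returns (e_{ℓ'+2},…,e_k , e_{k+1},…,e_n).
splitK : ℕ → List ℕ → List ℕ × List ℕ
splitK j [] = [] , []
splitK j (x ∷ xs) with (suc (suc j)) ≤ᵇ x
... | true = [] , x ∷ xs
... | false with splitK (suc j) xs
...   | m , t = x ∷ m , t

-- σ with a negative shift by d (= k - ℓ'): nonzero entries decreased by d.
σneg : ℕ → ℕ → ℕ
σneg d zero = zero
σneg d (suc x) = suc x ∸ d

-- τ with fuel; τ e = τ' (length e) e, the fuel is always sufficient since
-- both recursive arguments are strictly shorter than the input.
τ' : ℕ → List ℕ → Tree
τ' zero _ = leaf
τ' (suc f) [] = leaf
τ' (suc f) (e1 ∷ []) = leaf
τ' (suc f) (e1 ∷ e2 ∷ r) = node col (τ' f left) (τ' f right)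
  where
  rest : List ℕ
  rest = e2 ∷ r
  ℓ' : ℕ
  ℓ' = prefixLen e2 rest
  after : List ℕ
  after = Data.List.drop ℓ' rest
  parts : List ℕ × List ℕ
  parts = splitK 0 after
  mid : List ℕ
  mid = Data.Product.proj₁ parts
  tl : List ℕ
  tl = Data.Product.proj₂ parts
  -- k - ℓ' = length mid + 1
  left : List ℕ
  left = replicate ℓ' 0 ++ map (σneg (suc (length mid))) tl
  right : List ℕ
  right = 0 ∷ mid
  col : Color
  col = if e2 ≡ᵇ 0 then white else black

τ : List ℕ → Tree
τ e = τ' (length e) e

module Submission where

-- Unfolding the definition of τ on a sequence that starts
-- with at least two zeros, e = 0 0 0^k · z, the second entry is e₂ = 0, so the
-- root of τ(e) is white, and the run e₂ = … = e_{ℓ'+1} of equal entries has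
-- length ℓ' ≥ k + 1.  The left subtree is τ of 0^{ℓ'} · σ(…), which again
-- starts with at least k + 1 zeros.  Hence one step down the leftmost branch
-- costs exactly one leading zero, and by induction a sequence with k leading
-- zeros has its top k - 1 leftmost-branch nodes white.

open import Defs
open import Data.Nat using (ℕ; zero; suc; _+_; _≤_; _<_; z≤n; s≤s)
open import Data.Nat.Properties using (≤-refl; ≤-trans; m≤m+n)
open import Data.Fin using (Fin; toℕ)
open import Data.Vec using (Vec; lookup; toList; _∷_)
open import Data.Vec.Properties using (length-toList)
open import Data.List using (List; take; drop; replicate; length; _++_) renaming (_∷_ to _∷ₗ_)
open import Data.Product using (Σ; _×_; _,_)
open import Function using (_∘_)
open import Relation.Binary.PropositionalEquality using (_≡_; refl; cong; sym; subst; module ≡-Reasoning)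

prefixLen-zeros : ∀ k zs → k ≤ prefixLen 0 (replicate k 0 ++ zs)
prefixLen-zeros zero    zs = z≤n
prefixLen-zeros (suc k) zs = s≤s (prefixLen-zeros k zs)

τ-root-on-zeros : ∀ f k zs →
  Σ ℕ λ m → Σ (List ℕ) λ ys → Σ Tree λ r →
    suc k ≤ m × τ' (suc f) (0 ∷ₗ 0 ∷ₗ replicate k 0 ++ zs) ≡ node white (τ' f (replicate m 0 ++ ys)) r
τ-root-on-zeros f k zs = _ , _ , _ , prefixLen-zeros (suc k) zs , refl

leftBranch-white : ∀ f ℓ k zs → ℓ ≤ f → ℓ < k →
  take ℓ (leftBranch (τ' f (replicate k 0 ++ zs))) ≡ replicate ℓ white
leftBranch-white f zero k zs _ _ = refl
leftBranch-white (suc f) (suc ℓ) (suc (suc k)) zs (s≤s ℓ≤f) (s≤s ℓ≤k)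
  with τ-root-on-zeros f k zs
... | m , ys , r , k<m , unfold =
  begin
    take (suc ℓ) (leftBranch (τ' (suc f) (0 ∷ₗ 0 ∷ₗ replicate k 0 ++ zs)))
  ≡⟨ cong (take (suc ℓ) ∘ leftBranch) unfold ⟩
    white ∷ₗ take ℓ (leftBranch (τ' f (replicate m 0 ++ ys)))
  ≡⟨ cong (white ∷ₗ_) (leftBranch-white f ℓ m ys ℓ≤f (≤-trans ℓ≤k k<m)) ⟩
    white ∷ₗ replicate ℓ white
  ∎
  where open ≡-Reasoning

toList-zero-prefix : ∀ ℓ {n} (e : Vec ℕ n) → ℓ + 1 ≤ n →
  ((i : Fin n) → toℕ i ≤ ℓ → lookup e i ≡ 0) →
  toList e ≡ replicate (suc ℓ) 0 ++ drop (suc ℓ) (toList e)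
toList-zero-prefix zero (x ∷ e) _ zeros with zeros Fin.zero z≤n
... | refl = refl
toList-zero-prefix (suc ℓ) (x ∷ e) (s≤s ℓ+1≤n) zeros with zeros Fin.zero z≤n
... | refl = cong (0 ∷ₗ_) (toList-zero-prefix ℓ e ℓ+1≤n (λ i i≤ℓ → zeros (Fin.suc i) (s≤s i≤ℓ)))

corollary5 : (n : ℕ) → 1 ≤ n → (e : Vec ℕ n) → IsInvSeq e → Avoids021 e →
    (ℓ : ℕ) → ℓ + 1 ≤ n → ((i : Fin n) → toℕ i ≤ ℓ → lookup e i ≡ 0) →
    take ℓ (leftBranch (τ (toList e))) ≡ replicate ℓ white
corollary5 n _ e _ _ ℓ ℓ+1≤n zeros =
  subst (λ xs → take ℓ (leftBranch (τ' (length (toList e)) xs)) ≡ replicate ℓ white)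
    (sym (toList-zero-prefix ℓ e ℓ+1≤n zeros))
    (leftBranch-white (length (toList e)) ℓ (suc ℓ) _ ℓ≤fuel ≤-refl)
  where
  ℓ≤fuel : ℓ ≤ length (toList e)
  ℓ≤fuel = subst (ℓ ≤_) (sym (length-toList e)) (≤-trans (m≤m+n ℓ 1) ℓ+1≤n)
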